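{- Let $\mathbf{C}$ be the reflexive $4$-cycle: universe $C=\{0,1,2,3\}$ and one binary relation $E^{\mathbf{C}}=C^2\setminus\{(0,2),(2,0),(1,3),(3,1)\}$. Let $D=\{0,1,3\}$, and for $a,b,c\in C$ write $[abc]$ for the map $f: D\to C$ with $(f(0),f(1),f(3))=(a,b,c)$. For $b\in C$ let $\bar b$ denote the map $D^0\to C$ sending the empty tuple to $b$. Let $F$ be the encoding $\{\bar0,\bar1,\bar2,\bar3,[013],[010],[323],[313],[112],[003],[113]\}$. Then $\mathbf{C}$ is $F$-stable.
   Context: A $\wedge$-formula is a conjunction of atoms $R(v_1,\dots,v_k)$ and variable equalities with the usual satisfaction over a structure. For a finite set $S$, a set of maps $S\to C$ is $\wedge$-definable over $\mathbf{C}$ if it is the set of satisfying assignments $S\to C$ of a $\wedge$-formula with variables from $S$; $\langle T\rangle_{\mathbf{C}}$ is the smallest $\wedge$-definable set of maps containing $T$. An automorphism is a bijection of $C$ preserving $E^{\mathbf{C}}$ in both directions. A set $T$ of maps $I\to C$ is surjectively closed over $\mathbf{C}$ if every surjective map in $\langle T\rangle_{\mathbf{C}}$ equals $\gamma\circ t$ for an automorphism $\gamma$ and $t\in T$. For an encoding $F$ (finite set of maps $D^k\to C$, $k\ge 0$ the arity, $D^0=\{\text{empty tuple}\}$) and a finite set $V$: $G_{V,D}$ = all maps $V\to D$; a $(V,F)$-application is a pair $(\bar v,f)$, $f\in F$, $\bar v$ a tuple over $V$ of length the arity of $f$; $A_{V,F}$ the set of them; for $g\in G_{V,D}$ and $\alpha=((v_1,\dots,v_k),f)$,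 $\alpha[g]=f(g(v_1),\dots,g(v_k))$; $t[g]:A_{V,F}\to C$, $\alpha\mapsto\alpha[g]$; $T_V=\{t[g]\mid g\in G_{V,D}\}$. The structure is $F$-stable if for every non-empty finite $V$, every map in $T_V$ is surjective and $T_V$ is surjectively closed. -}

module Defs where

open import Data.Nat using (ℕ; suc)
open import Data.Fin using (Fin; zero; suc)
open import Data.Vec using (Vec; []; _∷_; map)
open import Data.List using (List; []; _∷_; length; lookup)
open import Data.List.Relation.Unary.All using (All)
open import Data.Product using (Σ; ∃; _×_; _,_)
open import Data.Bool using (Bool; true; false)
open import Relation.Binary.PropositionalEquality using (_≡_)
open import Function.Bundles using (_⇔_)

module General {C : Set} (E : C → C → Set) where

  data Atom (S : Set) : Set where
    rel : S → S → Atom S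
    eq  : S → S → Atom S

  Formula : Set → Set
  Formula S = List (Atom S)

  SatAtom : {S : Set} → (S → C) → Atom S → Set
  SatAtom s (rel x y) = E (s x) (s y)
  SatAtom s (eq x y)  = s x ≡ s y

  Sat : {S : Set} → (S → C) → Formula S → Set
  Sat s φ = All (SatAtom s) φ

  MapSet : Set → Set₁
  MapSet S = (S → C) → Set

  -- ⟨ T ⟩ : the smallest ∧-definable set containing T, i.e. the
  -- intersection of all ∧-definable sets containing T.
  Closure : {S : Set} → MapSet S → MapSet S
  Closure T s = ∀ φ → (∀ t → T t → Sat t φ) → Sat s φ

  Surj : {S : Set} → (S → C) → Set
  Surj {S} s = ∀ c → Σ S (λ a → s a ≡ c)

  Inj : (C → C) → Set
  Inj γ = ∀ x y → γ x ≡ γ y → x ≡ y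

  IsAutomorphism : (C → C) → Set
  IsAutomorphism γ = Inj γ × Surj γ × (∀ x y → E x y ⇔ E (γ x) (γ y))

  SurjectivelyClosed : {S : Set} → MapSet S → Set
  SurjectivelyClosed {S} T =
    ∀ s → Closure T s → Surj s →
      Σ (C → C) λ γ → IsAutomorphism γ ×
        Σ (S → C) λ t → T t × (∀ a → s a ≡ γ (t a))

  module Encodings (D : Set) where

    record EncMap : Set where
      field
        arity : ℕ
        fn    : Vec D arity → C
    open EncMap public

    -- an encoding: a finite (duplicate-free in our instance) list of maps
    Encoding : Set
    Encoding = List EncMap

    App : Set → Encoding → Set
    App V F = Σ (Fin (length F)) λ i → Vec V (arity (lookup F i))

    apply : (V : Set) (F : Encoding) → (V → D) → App V F → C
    apply V F g (i , vs) = fn (lookup F i) (map g vs)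

    -- T_V = { t[g] | g : V → D }  (maps compared pointwise)
    TV : (V : Set) (F : Encoding) → MapSet (App V F)
    TV V F t = Σ (V → D) λ g → ∀ α → t α ≡ apply V F g α

    -- F-stability; a non-empty finite set V is represented by Fin (suc n)
    Stable : Encoding → Set
    Stable F = ∀ (n : ℕ) →
      (∀ t → TV (Fin (suc n)) F t → Surj t) ×
      SurjectivelyClosed (TV (Fin (suc n)) F)

Cu : Set
Cu = Fin 4

c0 c1 c2 c3 : Cu
c0 = zero
c1 = suc zero
c2 = suc (suc zero)
c3 = suc (suc (suc zero))

adj : Cu → Cu → Bool
adj zero (suc (suc zero)) = false
adj (suc (suc zero)) zero = false
adj (suc zero) (suc (suc (suc zero))) = false
adj (suc (suc (suc zero))) (suc zero) = false
adj _ _ = true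

E4 : Cu → Cu → Set
E4 x y = adj x y ≡ true

data Du : Set where
  d0 d1 d3 : Du

open General E4 public
open Encodings Du public

un : Cu → Cu → Cu → EncMap
un a b c = record { arity = 1 ; fn = f }
  where
  f : Vec Du 1 → Cu
  f (d0 ∷ []) = a
  f (d1 ∷ []) = b
  f (d3 ∷ []) = c

const : Cu → EncMap
const b = record { arity = 0 ; fn = λ _ → b }

Fenc : Encoding
Fenc = const c0 ∷ const c1 ∷ const c2 ∷ const c3 ∷
       un c0 c1 c3 ∷ un c0 c1 c0 ∷ un c3 c2 c3 ∷ un c3 c1 c3 ∷
       un c1 c1 c2 ∷ un c0 c0 c3 ∷ un c1 c1 c3 ∷ []

-- A map s in ⟨T_V⟩ is determined by its constants (its values at the four constant
-- applications) and, for each v ∈ V, by its values at the seven applications (v, f) of the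
-- unary maps f ∈ F. Constants and unary values at v form the profile of s at v, a point of
-- C¹¹; the profiles of t[g] are the three columns indexed by g v ∈ D. Membership in the
-- ∧-closure forces every profile, and every pair of profiles at v and w, to satisfy all edge
-- atoms satisfied by the corresponding columns. Composing s with an automorphism of the
-- 4-cycle we may assume that the constants are (0, b, c, d) with b ≠ 3, and an exhaustive
-- search over these 48 tuples shows that either no profile exists at all, or the constants
-- are (0, 1, 2, 3) and every profile is a column, so that s = t[g], or there are colours c
-- and c′ missing from the constants such that no pair of profiles at v and w has c among
-- the unary values at v and c′ among those at w, which contradicts surjectivity of s.

module Submission where

open import Defs
open import Data.Bool using (Bool; true; false; T; if_then_else_)
open import Data.Bool.ListAction using (all)
open import Data.Bool.Properties using (T?) renaming (_≟_ to _≟ᵇ_)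
open import Data.Empty using (⊥-elim)
open import Data.Fin using (Fin; zero; suc; _↑ˡ_; _↑ʳ_)
open import Data.Fin.Properties using (_≟_) renaming (all? to ∀-Fin?; any? to ∃-Fin?)
open import Data.List as List using (List; []; _∷_; [_]; filter; cartesianProductWith)
open import Data.List.Membership.Propositional using (_∈_)
open import Data.List.Membership.Propositional.Properties
  using (∈-allFin; ∈-filter⁺; ∈-map⁺; ∈-cartesianProductWith⁺)
open import Data.List.Relation.Unary.All as All using (All; []; _∷_)
open import Data.List.Relation.Unary.All.Properties using (all⁺; map⁻)
open import Data.List.Relation.Unary.Any as Any using (Any; here; there; satisfied)
open import Data.Nat using (ℕ; zero; suc; _≤_; _≤?_; s≤s)
open import Data.Product using (Σ; ∃; ∃₂; _×_; _,_; proj₁; proj₂)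
open import Data.Sum using (_⊎_; inj₁; inj₂)
open import Data.Unit using (⊤; tt)
open import Data.Vec using (Vec; []; _∷_; lookup; tabulate; replicate; map; _++_; tail; allFin)
open import Data.Vec.Properties
  using (lookup-map; lookup∘tabulate; map-++; map-cong; map-replicate; tabulate-∘; tabulate-cong;
         tabulate∘lookup; ++-injectiveʳ)
  renaming (≡-dec to ≡-dec-Vec)
open import Data.Vec.Relation.Binary.Pointwise.Inductive using (Pointwise; []; _∷_; ++⁺; tabulate⁺)
open import Function using (_∘_; _⇔_; mk⇔; Equivalence)
open import Relation.Binary.PropositionalEquality
  using (_≡_; _≢_; refl; sym; trans; cong; cong₂; subst; subst₂; module ≡-Reasoning)
open import Relation.Nullary using (Dec; yes; no; ¬_; ¬?; _×-dec_; _⊎-dec_; _→-dec_)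
open import Relation.Nullary.Decidable using (isYes; toWitness; map′)

module ConjunctiveClosure {C : Set} (E : C → C → Set) where
  private module G = General E

  closure-satisfies : ∀ {S} {T : G.MapSet S} {s} → G.Closure T s →
                      (a : G.Atom S) → (∀ t → T t → G.SatAtom t a) → G.SatAtom s a
  closure-satisfies cl a valid = All.head (cl (a ∷ []) λ t t∈T → valid t t∈T ∷ [])

  closure-image : ∀ {S} {T : G.MapSet S} {s} (γ : C → C) →
                  (∀ x y → E x y → E (γ x) (γ y)) → G.Closure T s → G.Closure T (γ ∘ s)
  closure-image {s = s} γ hom cl φ valid = All.map (λ {a} → image a) (cl φ valid)
    where
    image : ∀ a → G.SatAtom s a → G.SatAtom (γ ∘ s) a
    image (G.rel x y) e = hom _ _ e
    image (G.eq x y)  e = cong γ e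

  surj-∘ : ∀ {S} {γ : C → C} {s : S → C} → G.Surj γ → G.Surj s → G.Surj (γ ∘ s)
  surj-∘ {γ = γ} γ-surj s-surj c =
    let b , γb≡c = γ-surj c
        a , sa≡b = s-surj b
    in a , trans (cong γ sa≡b) γb≡c

  inverse : ∀ {γ} → G.IsAutomorphism γ →
            Σ (C → C) λ δ → G.IsAutomorphism δ × (∀ x → δ (γ x) ≡ x)
  inverse {γ} (γ-inj , γ-surj , γ-pres) = δ , (δ-inj , δ-surj , δ-pres) , δ∘γ
    where
    δ : C → C
    δ c = proj₁ (γ-surj c)
    γ∘δ : ∀ c → γ (δ c) ≡ c
    γ∘δ c = proj₂ (γ-surj c)
    δ∘γ : ∀ x → δ (γ x) ≡ x
    δ∘γ x = γ-inj _ _ (γ∘δ (γ x))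
    δ-inj : G.Inj δ
    δ-inj x y δx≡δy = trans (sym (γ∘δ x)) (trans (cong γ δx≡δy) (γ∘δ y))
    δ-surj : G.Surj δ
    δ-surj x = γ x , δ∘γ x
    δ-pres : ∀ x y → E x y ⇔ E (δ x) (δ y)
    δ-pres x y = mk⇔
      (λ e → Equivalence.from (γ-pres (δ x) (δ y)) (subst₂ E (sym (γ∘δ x)) (sym (γ∘δ y)) e))
      (λ e → subst₂ E (γ∘δ x) (γ∘δ y) (Equivalence.to (γ-pres (δ x) (δ y)) e))

  Respects : ∀ {n} → List (Vec C n) → Vec C n → Set
  Respects cols xs =
    ∀ i j → All (λ c → E (lookup c i) (lookup c j)) cols → E (lookup xs i) (lookup xs j)

  closure-respects : ∀ {S n} {T : G.MapSet S} {s} (φ : Vec S n) {cols : List (Vec C n)} →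
                     (∀ t → T t → map t φ ∈ cols) → G.Closure T s → Respects cols (map s φ)
  closure-respects {s = s} φ cover cl i j valid =
    subst₂ E (sym (lookup-map i s φ)) (sym (lookup-map j s φ))
      (closure-satisfies cl (G.rel (lookup φ i) (lookup φ j)) λ t t∈T →
        subst₂ E (lookup-map i t φ) (lookup-map j t φ) (All.lookup valid (cover t t∈T)))

module _ {n : ℕ} {E : Fin n → Fin n → Set} (E? : ∀ x y → Dec (E x y)) where
  private module G = General E

  automorphism? : (γ : Fin n → Fin n) → Dec (G.IsAutomorphism γ)
  automorphism? γ =
    (∀-Fin? λ x → ∀-Fin? λ y → (γ x ≟ γ y) →-dec (x ≟ y)) ×-dec
    (∀-Fin? λ c → ∃-Fin? λ a → γ a ≟ c) ×-dec
    (∀-Fin? λ x → ∀-Fin? λ y → E? x y ⇔? E? (γ x) (γ y))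
    where
    _⇔?_ : ∀ {P Q : Set} → Dec P → Dec Q → Dec (P ⇔ Q)
    p? ⇔? q? = map′ (λ (f , g) → mk⇔ f g) (λ e → Equivalence.to e , Equivalence.from e)
                    ((p? →-dec q?) ×-dec (q? →-dec p?))

module PrunedSearch {A : Set} {E : A → A → Set} (E? : ∀ x y → Dec (E x y)) where
  open ConjunctiveClosure E using (Respects)

  Linked : A → A → Set
  Linked x y = E x y × E y x

  linked? : ∀ x y → Dec (Linked x y)
  linked? x y = E? x y ×-dec E? y x

  linkedAt : ∀ {n} → Vec A (suc n) → Fin n → Bool
  linkedAt c j = isYes (linked? (lookup c zero) (lookup c (suc j)))

  -- For each position, the later positions to which every column links it.
  data Shape : ℕ → Set where
    []  : Shape 0
    _∷_ : ∀ {n} → Vec Bool n → Shape n → Shape (suc n)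

  shape : ∀ {n} → List (Vec A n) → Shape n
  shape {zero}  cols = []
  shape {suc n} cols =
    tabulate (λ j → all (λ c → linkedAt c j) cols) ∷ shape (List.map tail cols)

  Fits : ∀ {n} → Shape n → Vec A n → Set
  Fits []          []       = ⊤
  Fits (mask ∷ sh) (x ∷ xs) = Pointwise (λ b y → T b → Linked x y) mask xs × Fits sh xs

  respects⇒fits : ∀ {n} (cols : List (Vec A n)) {xs} → Respects cols xs → Fits (shape cols) xs
  respects⇒fits {zero}  cols {[]}     _    = tt
  respects⇒fits {suc n} cols {x ∷ xs} resp =
    subst (Pointwise _ _) (tabulate∘lookup xs) (tabulate⁺ linked-to) ,
    respects⇒fits (List.map tail cols) later
    where
    linked-to : ∀ j → T (all (λ c → linkedAt c j) cols) → Linked x (lookup xs j)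
    linked-to j all-linked =
      let linked = All.map (λ {c} → toWitness {a? = linked? (lookup c zero) (lookup c (suc j))})
                           (all⁺ (λ c → linkedAt c j) cols all-linked)
      in resp zero (suc j) (All.map proj₁ linked) , resp (suc j) zero (All.map proj₂ linked)
    later : Respects (List.map tail cols) xs
    later i j valid = resp (suc i) (suc j) (All.map (λ { {_ ∷ _} e → e }) (map⁻ valid))

  Box : ℕ → Set
  Box = Vec (List A)

  _∈ᵇ_ : ∀ {n} → Vec A n → Box n → Set
  _∈ᵇ_ = Pointwise _∈_

  prune : ∀ {n} → A → Vec Bool n → Box n → Box n
  prune x []         []         = []
  prune x (b ∷ mask) (cs ∷ box) = (if b then filter (linked? x) cs else cs) ∷ prune x mask box

  -- Exhaustive search with forward checking: fixing a position filters the candidates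
  -- of the later positions linked to it.
  search : ∀ {n} → Shape n → Box n → (Vec A n → Bool) → Bool
  search []          []         G = G []
  search (mask ∷ sh) (cs ∷ box) G = all (λ x → search sh (prune x mask box) (G ∘ (x ∷_))) cs

  prune-sound : ∀ {n x} {mask : Vec Bool n} {ys box} →
                Pointwise (λ b y → T b → Linked x y) mask ys → ys ∈ᵇ box → ys ∈ᵇ prune x mask box
  prune-sound []                        []           = []
  prune-sound {mask = true ∷ _}  (l ∷ ls) (y∈ ∷ ys∈) =
    ∈-filter⁺ (linked? _) y∈ (l tt) ∷ prune-sound ls ys∈
  prune-sound {mask = false ∷ _} (_ ∷ ls) (y∈ ∷ ys∈) = y∈ ∷ prune-sound ls ys∈

  search-sound : ∀ {n} (sh : Shape n) box G {xs} →
                 T (search sh box G) → Fits sh xs → xs ∈ᵇ box → T (G xs)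
  search-sound []          []         G {[]}     ok _               _                = ok
  search-sound (mask ∷ sh) (cs ∷ box) G {x ∷ xs} ok (linked , fits) (x∈cs ∷ xs∈box) =
    search-sound sh (prune x mask box) (G ∘ (x ∷_)) (All.lookup (all⁺ _ cs ok) x∈cs) fits
                 (prune-sound linked xs∈box)

E4? : ∀ x y → Dec (E4 x y)
E4? x y = adj x y ≟ᵇ true

open ConjunctiveClosure E4
open PrunedSearch E4?

colours : List Cu
colours = List.allFin 4

domain : List Du
domain = d0 ∷ d1 ∷ d3 ∷ []

∈-domain : ∀ d → d ∈ domain
∈-domain d0 = here refl
∈-domain d1 = there (here refl)
∈-domain d3 = there (there (here refl))

-- The value at d of the i-th map of F; the four constant maps come first.
colour : Du → Fin 11 → Cu
colour d i = fn (List.lookup Fenc i) (replicate _ d)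

colour-constant : ∀ d (c : Cu) → colour d (c ↑ˡ 7) ≡ c
colour-constant d zero                   = refl
colour-constant d (suc zero)             = refl
colour-constant d (suc (suc zero))       = refl
colour-constant d (suc (suc (suc zero))) = refl

data Position : Fin 11 → Set where
  constant : (c : Cu)    → Position (c ↑ˡ 7)
  unary    : (j : Fin 7) → Position (4 ↑ʳ j)

position : ∀ i → Position i
position zero                         = constant zero
position (suc zero)                   = constant (suc zero)
position (suc (suc zero))             = constant (suc (suc zero))
position (suc (suc (suc zero)))       = constant (suc (suc (suc zero)))
position (suc (suc (suc (suc j))))    = unary j

arity≤1 : ∀ i → arity (List.lookup Fenc i) ≤ 1
arity≤1 = toWitness {a? = ∀-Fin? λ i → arity (List.lookup Fenc i) ≤? 1} _

unaryColumn : Du → Vec Cu 7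
unaryColumn d = tabulate λ j → colour d (4 ↑ʳ j)

column : Du → Vec Cu 11
column d = allFin 4 ++ unaryColumn d

pairColumn : Du → Du → Vec Cu 18
pairColumn d e = allFin 4 ++ unaryColumn d ++ unaryColumn e

columns : List (Vec Cu 11)
columns = List.map column domain

pairColumns : List (Vec Cu 18)
pairColumns = cartesianProductWith pairColumn domain domain

fixed : ∀ {n} → Vec Cu n → Box n
fixed = map [_]

free : Box 7
free = tabulate λ _ → colours

pinned : Fin 7 → Cu → Box 7
pinned j c = tabulate λ i → if isYes (i ≟ j) then [ c ] else colours

∈-fixed : ∀ {n} (xs : Vec Cu n) → xs ∈ᵇ fixed xs
∈-fixed []       = []
∈-fixed (x ∷ xs) = here refl ∷ ∈-fixed xs

∈-free : ∀ xs → xs ∈ᵇ free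
∈-free xs = subst (_∈ᵇ free) (tabulate∘lookup xs) (tabulate⁺ {f = lookup xs} λ _ → ∈-allFin _)

∈-pinned : ∀ {xs j c} → lookup xs j ≡ c → xs ∈ᵇ pinned j c
∈-pinned {xs} {j} {c} xs[j]≡c = subst (_∈ᵇ pinned j c) (tabulate∘lookup xs) (tabulate⁺ member)
  where
  member : ∀ i → lookup xs i ∈ (if isYes (i ≟ j) then [ c ] else colours)
  member i with i ≟ j
  ... | yes refl = here xs[j]≡c
  ... | no _     = ∈-allFin _

column? : ∀ xs → Dec (Any (λ d → xs ≡ column d) domain)
column? xs = Any.any? (λ d → ≡-dec-Vec _≟_ xs (column d)) domain

NoProfile : Vec Cu 4 → Set
NoProfile k = T (search (shape columns) (fixed k ++ free) λ _ → false)

ProfilesAreColumns : Set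
ProfilesAreColumns = T (search (shape columns) (fixed (allFin 4) ++ free) (isYes ∘ column?))

Missing : Vec Cu 4 → Cu → Set
Missing k c = ∀ i → lookup k i ≢ c

Separated : Vec Cu 4 → Cu → Cu → Set
Separated k c c′ =
  ∀ j j′ → T (search (shape pairColumns) (fixed k ++ pinned j c ++ pinned j′ c′) λ _ → false)

Classification : Vec Cu 4 → Set
Classification k =
  NoProfile k ⊎ (k ≡ allFin 4 × ProfilesAreColumns) ⊎
  ∃₂ λ c c′ → Missing k c × Missing k c′ × Separated k c c′

classification? : ∀ k → Dec (Classification k)
classification? k =
  T? _ ⊎-dec (≡-dec-Vec _≟_ k (allFin 4) ×-dec T? _) ⊎-dec
  (∃-Fin? λ c → ∃-Fin? λ c′ → missing? c ×-dec missing? c′ ×-dec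
                               (∀-Fin? λ j → ∀-Fin? λ j′ → T? _))
  where
  missing? : ∀ c → Dec (Missing k c)
  missing? c = ∀-Fin? λ i → ¬? (lookup k i ≟ c)

-- The eight symmetries of the square 0-1-2-3, as the images of (0,1,2,3).
symmetries : List (Vec Cu 4)
symmetries =
  (c0 ∷ c1 ∷ c2 ∷ c3 ∷ []) ∷ (c1 ∷ c2 ∷ c3 ∷ c0 ∷ []) ∷
  (c2 ∷ c3 ∷ c0 ∷ c1 ∷ []) ∷ (c3 ∷ c0 ∷ c1 ∷ c2 ∷ []) ∷
  (c0 ∷ c3 ∷ c2 ∷ c1 ∷ []) ∷ (c1 ∷ c0 ∷ c3 ∷ c2 ∷ []) ∷
  (c2 ∷ c1 ∷ c0 ∷ c3 ∷ []) ∷ (c3 ∷ c2 ∷ c1 ∷ c0 ∷ []) ∷ []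

-- Both facts below are established by evaluating a decision procedure; `abstract` keeps the
-- type checker from evaluating it again wherever they are used.
abstract
  classification : ∀ k → lookup k zero ≡ c0 → lookup k (suc zero) ≢ c3 → Classification k
  classification (_ ∷ b ∷ c ∷ d ∷ []) refl = normalised b c d
    where
    normalised : ∀ b c d → b ≢ c3 → Classification (c0 ∷ b ∷ c ∷ d ∷ [])
    normalised = toWitness {a? = ∀-Fin? λ b → ∀-Fin? λ c → ∀-Fin? λ d →
      ¬? (b ≟ c3) →-dec classification? (c0 ∷ b ∷ c ∷ d ∷ [])} _

  normaliser : ∀ a b → ∃ λ ρ → IsAutomorphism ρ × ρ a ≡ c0 × ρ b ≢ c3
  normaliser a b = let ρ , p = satisfied (normalising a b) in lookup ρ , p
    where
    normalising : ∀ a b → Any (λ ρ → IsAutomorphism (lookup ρ) × lookup ρ a ≡ c0 × lookup ρ b ≢ c3)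
                              symmetries
    normalising = toWitness {a? = ∀-Fin? λ a → ∀-Fin? λ b → Any.any? (λ ρ →
      automorphism? E4? (lookup ρ) ×-dec lookup ρ a ≟ c0 ×-dec ¬? (lookup ρ b ≟ c3)) symmetries} _

module Applications (n : ℕ) where
  V : Set
  V = Fin (suc n)

  at : V → Fin 11 → App V Fenc
  at v i = i , replicate _ v

  apply-at : ∀ g v i → apply V Fenc g (at v i) ≡ colour (g v) i
  apply-at g v i = cong (fn (List.lookup Fenc i)) (map-replicate g v _)

  at-exhaustive : ∀ α → Σ V λ v → α ≡ at v (proj₁ α)
  at-exhaustive (i , vs) = let v , vs≡ = constant-vector vs (arity≤1 i) in v , cong (i ,_) vs≡
    where
    constant-vector : ∀ {m} (vs : Vec V m) → m ≤ 1 → Σ V λ v → vs ≡ replicate m v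
    constant-vector []          _        = zero , refl
    constant-vector (v ∷ [])    _        = v , refl
    constant-vector (_ ∷ _ ∷ _) (s≤s ())

  at-constant : ∀ v (c : Cu) → at v (c ↑ˡ 7) ≡ at zero (c ↑ˡ 7)
  at-constant v zero                   = refl
  at-constant v (suc zero)             = refl
  at-constant v (suc (suc zero))       = refl
  at-constant v (suc (suc (suc zero))) = refl

  constantApps : Vec (App V Fenc) 4
  constantApps = tabulate λ c → at zero (c ↑ˡ 7)

  unaryApps : V → Vec (App V Fenc) 7
  unaryApps v = tabulate λ j → at v (4 ↑ʳ j)

  constants : (App V Fenc → Cu) → Vec Cu 4
  constants s = map s constantApps

  unaries : (App V Fenc → Cu) → V → Vec Cu 7
  unaries s v = map s (unaryApps v)

  profile : (App V Fenc → Cu) → V → Vec Cu 11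
  profile s v = constants s ++ unaries s v

  pairProfile : (App V Fenc → Cu) → V → V → Vec Cu 18
  pairProfile s v w = constants s ++ unaries s v ++ unaries s w

  lookup-constants : ∀ s c → lookup (constants s) c ≡ s (at zero (c ↑ˡ 7))
  lookup-constants s c =
    trans (lookup-map c s constantApps) (cong s (lookup∘tabulate (λ c → at zero (c ↑ˡ 7)) c))

  lookup-unaries : ∀ s v j → lookup (unaries s v) j ≡ s (at v (4 ↑ʳ j))
  lookup-unaries s v j =
    trans (lookup-map j s (unaryApps v)) (cong s (lookup∘tabulate (λ j → at v (4 ↑ʳ j)) j))

  constants-apply : ∀ g → constants (apply V Fenc g) ≡ allFin 4
  constants-apply g = trans (sym (tabulate-∘ (apply V Fenc g) λ c → at zero (c ↑ˡ 7)))
    (tabulate-cong λ c → trans (apply-at g zero (c ↑ˡ 7)) (colour-constant (g zero) c))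

  unaries-apply : ∀ g v → unaries (apply V Fenc g) v ≡ unaryColumn (g v)
  unaries-apply g v = trans (sym (tabulate-∘ (apply V Fenc g) λ j → at v (4 ↑ʳ j)))
    (tabulate-cong λ j → apply-at g v (4 ↑ʳ j))

  determined : ∀ {s s′} → constants s ≡ constants s′ → (∀ v → unaries s v ≡ unaries s′ v) →
               ∀ α → s α ≡ s′ α
  determined {s} {s′} ks us α =
    let v , α≡ = at-exhaustive α in
    trans (cong s α≡) (trans (at-determined v (proj₁ α)) (cong s′ (sym α≡)))
    where
    open ≡-Reasoning
    at-determined : ∀ v i → s (at v i) ≡ s′ (at v i)
    at-determined v i with position i
    ... | constant c = begin
      s (at v (c ↑ˡ 7))         ≡⟨ cong s (at-constant v c) ⟩
      s (at zero (c ↑ˡ 7))      ≡⟨ sym (lookup-constants s c) ⟩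
      lookup (constants s) c    ≡⟨ cong (λ k → lookup k c) ks ⟩
      lookup (constants s′) c   ≡⟨ lookup-constants s′ c ⟩
      s′ (at zero (c ↑ˡ 7))     ≡⟨ cong s′ (sym (at-constant v c)) ⟩
      s′ (at v (c ↑ˡ 7))        ∎
    ... | unary j = begin
      s (at v (4 ↑ʳ j))         ≡⟨ sym (lookup-unaries s v j) ⟩
      lookup (unaries s v) j    ≡⟨ cong (λ u → lookup u j) (us v) ⟩
      lookup (unaries s′ v) j   ≡⟨ lookup-unaries s′ v j ⟩
      s′ (at v (4 ↑ʳ j))        ∎

  occurs-in-unaries : ∀ {s c} → Surj s → Missing (constants s) c →
                      ∃₂ λ v j → lookup (unaries s v) j ≡ c
  occurs-in-unaries {s} {c} surj missing =
    let α , sα≡c = surj c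
        v , α≡ = at-exhaustive α
    in occurs v (proj₁ α) (trans (cong s (sym α≡)) sα≡c)
    where
    occurs : ∀ v i → s (at v i) ≡ c → ∃₂ λ v j → lookup (unaries s v) j ≡ c
    occurs v i s[v,i]≡c with position i
    ... | constant c₀ =
      ⊥-elim (missing c₀ (trans (lookup-constants s c₀)
                                (trans (cong s (sym (at-constant v c₀))) s[v,i]≡c)))
    ... | unary j = v , j , trans (lookup-unaries s v j) s[v,i]≡c

  singleApps : V → Vec (App V Fenc) 11
  singleApps v = constantApps ++ unaryApps v

  pairApps : V → V → Vec (App V Fenc) 18
  pairApps v w = constantApps ++ unaryApps v ++ unaryApps w

  profile-map : ∀ s v → map s (singleApps v) ≡ profile s v
  profile-map s v = map-++ s constantApps (unaryApps v)

  pairProfile-map : ∀ s v w → map s (pairApps v w) ≡ pairProfile s v w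
  pairProfile-map s v w =
    trans (map-++ s constantApps _) (cong (constants s ++_) (map-++ s (unaryApps v) (unaryApps w)))

  T-profile : ∀ t → TV V Fenc t → ∀ v → map t (singleApps v) ∈ columns
  T-profile t (g , t≗) v = subst (_∈ columns) (sym profile≡) (∈-map⁺ column (∈-domain (g v)))
    where
    profile≡ : map t (singleApps v) ≡ column (g v)
    profile≡ = trans (map-cong t≗ _) (trans (profile-map (apply V Fenc g) v)
                 (cong₂ _++_ (constants-apply g) (unaries-apply g v)))

  T-pairProfile : ∀ t → TV V Fenc t → ∀ v w → map t (pairApps v w) ∈ pairColumns
  T-pairProfile t (g , t≗) v w =
    subst (_∈ pairColumns) (sym profile≡)
      (∈-cartesianProductWith⁺ pairColumn (∈-domain (g v)) (∈-domain (g w)))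
    where
    profile≡ : map t (pairApps v w) ≡ pairColumn (g v) (g w)
    profile≡ = trans (map-cong t≗ _) (trans (pairProfile-map (apply V Fenc g) v w)
                 (cong₂ _++_ (constants-apply g)
                             (cong₂ _++_ (unaries-apply g v) (unaries-apply g w))))

  T-surjective : ∀ t → TV V Fenc t → Surj t
  T-surjective t (g , t≗) c =
    at zero (c ↑ˡ 7) , trans (t≗ _) (trans (apply-at g zero (c ↑ˡ 7)) (colour-constant (g zero) c))

  module _ {s : App V Fenc → Cu} (cl : Closure (TV V Fenc) s) where

    profile-fits : ∀ v → Fits (shape columns) (profile s v)
    profile-fits v = respects⇒fits columns (subst (Respects columns) (profile-map s v)
      (closure-respects (singleApps v) (λ t t∈T → T-profile t t∈T v) cl))

    pairProfile-fits : ∀ v w → Fits (shape pairColumns) (pairProfile s v w)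
    pairProfile-fits v w =
      respects⇒fits pairColumns (subst (Respects pairColumns) (pairProfile-map s v w)
      (closure-respects (pairApps v w) (λ t t∈T → T-pairProfile t t∈T v w) cl))

    no-profile : ¬ NoProfile (constants s)
    no-profile none =
      search-sound (shape columns) (fixed (constants s) ++ free) (λ _ → false) none
                   (profile-fits zero) (++⁺ (∈-fixed (constants s)) (∈-free _))

    not-separated : Surj s → ∀ {c c′} → Missing (constants s) c → Missing (constants s) c′ →
                    ¬ Separated (constants s) c c′
    not-separated surj {c} {c′} m m′ separated =
      let v , j , c-at = occurs-in-unaries surj m
          w , j′ , c′-at = occurs-in-unaries surj m′
      in search-sound (shape pairColumns) (fixed (constants s) ++ pinned j c ++ pinned j′ c′)
                      (λ _ → false) (separated j j′) (pairProfile-fits v w)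
                      (++⁺ (∈-fixed (constants s))
                           (++⁺ (∈-pinned {unaries s v} c-at) (∈-pinned {unaries s w} c′-at)))

    profiles-are-columns : constants s ≡ allFin 4 → ProfilesAreColumns → TV V Fenc s
    profiles-are-columns k≡id profiles =
      g , determined (trans k≡id (sym (constants-apply g)))
                     (λ v → trans (unaries-column v) (sym (unaries-apply g v)))
      where
      column-at : ∀ v → ∃ λ d → profile s v ≡ column d
      column-at v = satisfied (toWitness {a? = column? (profile s v)}
        (search-sound (shape columns) (fixed (allFin 4) ++ free) (isYes ∘ column?) profiles
          (profile-fits v)
          (subst (λ k → profile s v ∈ᵇ (fixed k ++ free)) k≡id
                 (++⁺ (∈-fixed (constants s)) (∈-free _)))))
      g : V → Du
      g v = proj₁ (column-at v)
      unaries-column : ∀ v → unaries s v ≡ unaryColumn (g v)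
      unaries-column v = ++-injectiveʳ (constants s) (allFin 4) (proj₂ (column-at v))

    member-of-T : Surj s → Classification (constants s) → TV V Fenc s
    member-of-T surj (inj₁ none)                          = ⊥-elim (no-profile none)
    member-of-T surj (inj₂ (inj₁ (k≡id , profiles)))      = profiles-are-columns k≡id profiles
    member-of-T surj (inj₂ (inj₂ (_ , _ , m , m′ , sep))) = ⊥-elim (not-separated surj m m′ sep)

  surjectively-closed : SurjectivelyClosed (TV V Fenc)
  surjectively-closed s cl surj =
    let ρ , ρ-aut , ρk₀≡0 , ρk₁≢3 =
          normaliser (lookup (constants s) zero) (lookup (constants s) (suc zero))
        δ , δ-aut , δρ≡id = inverse ρ-aut
        _ , ρ-surj , ρ-pres = ρ-aut
        g , ρs≗t[g] = member-of-T {ρ ∘ s} (closure-image ρ (λ x y → Equivalence.to (ρ-pres x y)) cl)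
                        (surj-∘ ρ-surj surj) (classification (constants (ρ ∘ s)) ρk₀≡0 ρk₁≢3)
    in δ , δ-aut , apply V Fenc g , (g , λ _ → refl) ,
       λ α → trans (sym (δρ≡id (s α))) (cong δ (ρs≗t[g] α))

theorem3p1 : Stable Fenc
theorem3p1 n = T-surjective , surjectively-closed
  where open Applications n
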